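{- Let $\mathsf{JL}$ be a justification logic and $\mathcal{CS}$ a constant specification for $\mathsf{JL}$. If a formula $A$ is $\mathsf{JL}_{\mathcal{CS}}$-valid, then $A$ has a $\mathsf{JL}_{\mathcal{CS}}$-tableau proof.
   Context: Language. Justification terms are built from justification variables and constants using binary $\cdot,+$ and unary $!,\bar?,?$. Formulas: $A ::= p \mid \bot \mid \neg A \mid A\to A \mid t:A$, $p$ from a countable set $\mathcal P$ of propositional variables. Logics. $\mathsf J$ has axiom schemes: all propositional tautologies; $s:A\to(s+t):A$, $s:A\to(t+s):A$; $s:(A\to B)\to(t:A\to(s\cdot t):B)$. Further schemes: jT: $t:A\to A$; jD: $t:\bot\to\bot$; j4: $t:A\to\,!t:t:A$; jB: $\neg A\to\bar{?}t:\neg t:A$; j5: $\neg t:A\to ?t:\neg t:A$. A justification logic $\mathsf{JL}$ is $\mathsf J$ plus any combination of these; its language contains $\cdot,+$ and those of $!,\bar?,?$ occurring in its axioms; $Tm_{\mathsf{JL}},Fm_{\mathsf{JL}}$ are its terms and formulas. A constant specification $\mathcal{CS}$ for $\mathsf{JL}$ is a downward closed set of formulas $c_{i_n}:\dots:c_{i_1}:A$ ($n\ge1$, constants $c_{i_j}$, $A$ an axiom instance of $\mathsf{JL}$): if $c_{i_n}:c_{i_{n-1}}:\dots:c_{i_1}:A\in\mathcal{CS}$, $n\ge2$, then $c_{i_{n-1}}:\dots:c_{i_1}:A\in\mathcal{CS}$. Models. A $\mathsf{JL}_{\mathcal{CS}}$-model is $\mathcal M=(\mathcal E,\mathcal V)$,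 $\mathcal V:\mathcal P\to\{0,1\}$, $\mathcal E:Tm_{\mathsf{JL}}\to2^{Fm_{\mathsf{JL}}}$ with: (E1) $A\to B\in\mathcal E(s)$, $A\in\mathcal E(t)$ imply $B\in\mathcal E(s\cdot t)$; (E2) $\mathcal E(s)\cup\mathcal E(t)\subseteq\mathcal E(s+t)$; (E3) $c:F\in\mathcal{CS}$ implies $F\in\mathcal E(c)$; if jD: (E4) $\bot\notin\mathcal E(t)$; if j4: (E5) $A\in\mathcal E(t)\Rightarrow t:A\in\mathcal E(!t)$; if jB: (E6) $\mathcal M\not\Vdash A\Rightarrow\neg t:A\in\mathcal E(\bar?t)$; if j5: (E7) $A\notin\mathcal E(t)\Rightarrow\neg t:A\in\mathcal E(?t)$. Forcing: $\mathcal M\not\Vdash\bot$; $\mathcal M\Vdash p$ iff $\mathcal V(p)=1$; $\neg,\to$ classical; $\mathcal M\Vdash t:A$ iff $A\in\mathcal E(t)$ (without jT), resp. iff $A\in\mathcal E(t)$ and $\mathcal M\Vdash A$ (with jT). $F$ is $\mathsf{JL}_{\mathcal{CS}}$-valid if forced in every $\mathsf{JL}_{\mathcal{CS}}$-model. $\mathsf{JL}_{\mathcal{CS}}$-tableaux. A tableau for a finite set $S$ starts with a single branch of the formulas of $S$ (the root) and is extended by rule applications whose premises lie on the extended branch. Rules: $(F\neg)$: $\neg\neg A$ / $A$; $(F\to)$: $\neg(A\to B)$ / $A,\neg B$; $(T\to)$: $A\to B$ / $\neg A$ | $B$; $(F+)$: $\neg(t+s):A$ / $\neg t:A,\neg s:A$;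 $(F\cdot)$: $\neg(s\cdot t):B$ / $\neg s:(A\to B)$ | $\neg t:A$ for any formula $A$. Additionally: with jT, $(T:)$: $t:A$ / $A$; with jD, $(F:_\bot)$: add $\neg t:\bot$ for any term $t$; with j4, $(F!)$: $\neg!t:t:A$ / $\neg t:A$; with jB, $(F\bar?)$: $\neg\bar?t:\neg t:A$ / $A$; with j5, $(F?)$: $\neg?t:\neg t:A$ / $t:A$. A branch closes if it contains $A$ and $\neg A$, or $\bot$, or $\neg c:F$ with $c:F\in\mathcal{CS}$; a tableau is closed if all branches close. A $\mathsf{JL}_{\mathcal{CS}}$-tableau proof of $F$ is a closed $\mathsf{JL}_{\mathcal{CS}}$-tableau with root $\neg F$. -}

module Defs where

open import Data.Nat using (ℕ)
open import Data.Bool using (Bool; true; false; T; _∧_; not; _∨_)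
open import Data.List using (List; _∷_; [])
open import Data.List.Membership.Propositional using (_∈_)
open import Data.Product using (_×_; Σ; _,_)
open import Data.Unit using (⊤)
open import Data.Empty renaming (⊥ to Empty)
open import Relation.Nullary using (¬_; Dec)
open import Relation.Binary.PropositionalEquality using (_≡_)
open import Level using (suc; zero)

-- A justification logic JL = J + a selection of jT, jD, j4, jB, j5.

record Logic : Set where
  field
    jT jD j4 jB j5 : Bool
open Logic public

infixl 7 _·_
infixl 6 _+ₜ_

data Tm (L : Logic) : Set where
  var   : ℕ → Tm L
  con   : ℕ → Tm L
  _·_   : Tm L → Tm L → Tm L
  _+ₜ_  : Tm L → Tm L → Tm L
  !_    : {p : T (j4 L)} → Tm L → Tm L
  ¿_    : {p : T (jB L)} → Tm L → Tm L
  ⁇_    : {p : T (j5 L)} → Tm L → Tm L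

infixr 5 _⇒_
infixr 6 _∶_
infix 7 ~_

data Fm (L : Logic) : Set where
  at  : ℕ → Fm L
  ⊥f  : Fm L
  ~_  : Fm L → Fm L
  _⇒_ : Fm L → Fm L → Fm L
  _∶_ : Tm L → Fm L → Fm L

-- Propositional tautologies: formulas true under every classical
-- valuation of the prime formulas (propositional variables and t:A).

evalB : {L : Logic} → (ℕ → Bool) → (Tm L → Fm L → Bool) → Fm L → Bool
evalB v w (at p)  = v p
evalB v w ⊥f      = false
evalB v w (~ A)   = not (evalB v w A)
evalB v w (A ⇒ B) = not (evalB v w A) ∨ evalB v w B
evalB v w (t ∶ A) = w t A

Tautology : {L : Logic} → Fm L → Set
Tautology {L} A = (v : ℕ → Bool) (w : Tm L → Fm L → Bool) → evalB v w A ≡ true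

data Axiom (L : Logic) : Fm L → Set where
  taut  : ∀ {A} → Tautology A → Axiom L A
  suml  : ∀ s t A → Axiom L (s ∶ A ⇒ (s +ₜ t) ∶ A)
  sumr  : ∀ s t A → Axiom L (s ∶ A ⇒ (t +ₜ s) ∶ A)
  appl  : ∀ s t A B → Axiom L (s ∶ (A ⇒ B) ⇒ (t ∶ A ⇒ (s · t) ∶ B))
  axT   : T (jT L) → ∀ t A → Axiom L (t ∶ A ⇒ A)
  axD   : T (jD L) → ∀ t → Axiom L (t ∶ ⊥f ⇒ ⊥f)
  ax4   : (p : T (j4 L)) → ∀ t A → Axiom L (t ∶ A ⇒ (!_ {p = p} t) ∶ t ∶ A)
  axB   : (p : T (jB L)) → ∀ t A → Axiom L (~ A ⇒ (¿_ {p = p} t) ∶ ~ (t ∶ A))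
  ax5   : (p : T (j5 L)) → ∀ t A → Axiom L (~ (t ∶ A) ⇒ (⁇_ {p = p} t) ∶ ~ (t ∶ A))

data ConstIter (L : Logic) : Fm L → Set where
  base : ∀ c {A} → Axiom L A → ConstIter L (con c ∶ A)
  step : ∀ c {F} → ConstIter L F → ConstIter L (con c ∶ F)

record CS (L : Logic) : Set₁ where
  field
    mem  : Fm L → Set
    wf   : ∀ F → mem F → ConstIter L F
    down : ∀ c F → mem (con c ∶ F) → ConstIter L F → mem F
open CS public

ifT : Bool → Set → Set
ifT true  P = P
ifT false P = ⊤

Forces : {L : Logic} → (Tm L → Fm L → Set) → (ℕ → Bool) → Fm L → Set
Forces E V (at p)  = V p ≡ true
Forces E V ⊥f      = Empty
Forces E V (~ A)   = ¬ Forces E V A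
Forces E V (A ⇒ B) = Forces E V A → Forces E V B
Forces {L} E V (t ∶ A) = E t A × ifT (jT L) (Forces E V A)

record Model (L : Logic) (𝒞 : CS L) : Set₁ where
  field
    E  : Tm L → Fm L → Set
    V  : ℕ → Bool
    E1 : ∀ s t A B → E s (A ⇒ B) → E t A → E (s · t) B
    E2 : ∀ s t A → (E s A → E (s +ₜ t) A) × (E t A → E (s +ₜ t) A)
    E3 : ∀ c F → mem 𝒞 (con c ∶ F) → E (con c) F
    E4 : T (jD L) → ∀ t → ¬ E t ⊥f
    E5 : (p : T (j4 L)) → ∀ t A → E t A → E (!_ {p = p} t) (t ∶ A)
    E6 : (p : T (jB L)) → ∀ t A → ¬ Forces E V A → E (¿_ {p = p} t) (~ (t ∶ A))
    E7 : (p : T (j5 L)) → ∀ t A → ¬ E t A → E (⁇_ {p = p} t) (~ (t ∶ A))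
open Model public

_⊨_ : {L : Logic} {𝒞 : CS L} → Model L 𝒞 → Fm L → Set
M ⊨ A = Forces (E M) (V M) A

Valid : (L : Logic) (𝒞 : CS L) → Fm L → Set₁
Valid L 𝒞 A = (M : Model L 𝒞) → M ⊨ A

-- Closed JL_CS-tableaux.  `ClosedTableau L 𝒞 Γ` is (the tree of) a closed
-- tableau whose current branch contains exactly the formulas of Γ:
-- either the branch closes, or a rule is applied to a premise on the
-- branch, and each resulting branch is in turn closed.

data ClosedTableau (L : Logic) (𝒞 : CS L) : List (Fm L) → Set where
  clash   : ∀ {Γ} A → A ∈ Γ → ~ A ∈ Γ → ClosedTableau L 𝒞 Γ
  clashBot : ∀ {Γ} → ⊥f ∈ Γ → ClosedTableau L 𝒞 Γ
  clashCS : ∀ {Γ} c F → ~ (con c ∶ F) ∈ Γ → mem 𝒞 (con c ∶ F) → ClosedTableau L 𝒞 Γ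
  F¬  : ∀ {Γ} A → ~ ~ A ∈ Γ → ClosedTableau L 𝒞 (A ∷ Γ) → ClosedTableau L 𝒞 Γ
  F⇒  : ∀ {Γ} A B → ~ (A ⇒ B) ∈ Γ → ClosedTableau L 𝒞 (A ∷ ~ B ∷ Γ) → ClosedTableau L 𝒞 Γ
  T⇒  : ∀ {Γ} A B → (A ⇒ B) ∈ Γ → ClosedTableau L 𝒞 (~ A ∷ Γ) → ClosedTableau L 𝒞 (B ∷ Γ)
        → ClosedTableau L 𝒞 Γ
  F+  : ∀ {Γ} t s A → ~ ((t +ₜ s) ∶ A) ∈ Γ → ClosedTableau L 𝒞 (~ (t ∶ A) ∷ ~ (s ∶ A) ∷ Γ)
        → ClosedTableau L 𝒞 Γ
  F·  : ∀ {Γ} s t B → ~ ((s · t) ∶ B) ∈ Γ → (A : Fm L)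
        → ClosedTableau L 𝒞 (~ (s ∶ (A ⇒ B)) ∷ Γ) → ClosedTableau L 𝒞 (~ (t ∶ A) ∷ Γ)
        → ClosedTableau L 𝒞 Γ
  T∶  : T (jT L) → ∀ {Γ} t A → (t ∶ A) ∈ Γ → ClosedTableau L 𝒞 (A ∷ Γ) → ClosedTableau L 𝒞 Γ
  F∶⊥ : T (jD L) → ∀ {Γ} t → ClosedTableau L 𝒞 (~ (t ∶ ⊥f) ∷ Γ) → ClosedTableau L 𝒞 Γ
  F!  : (p : T (j4 L)) → ∀ {Γ} t A → ~ ((!_ {p = p} t) ∶ t ∶ A) ∈ Γ
        → ClosedTableau L 𝒞 (~ (t ∶ A) ∷ Γ) → ClosedTableau L 𝒞 Γ
  F¿  : (p : T (jB L)) → ∀ {Γ} t A → ~ ((¿_ {p = p} t) ∶ ~ (t ∶ A)) ∈ Γ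
        → ClosedTableau L 𝒞 (A ∷ Γ) → ClosedTableau L 𝒞 Γ
  F⁇  : (p : T (j5 L)) → ∀ {Γ} t A → ~ ((⁇_ {p = p} t) ∶ ~ (t ∶ A)) ∈ Γ
        → ClosedTableau L 𝒞 ((t ∶ A) ∷ Γ) → ClosedTableau L 𝒞 Γ

TableauProof : (L : Logic) (𝒞 : CS L) → Fm L → Set
TableauProof L 𝒞 F = ClosedTableau L 𝒞 (~ F ∷ [])

ExcludedMiddle : Set₁
ExcludedMiddle = (P : Set) → Dec P

-- If A has no tableau proof, the one-formula branch ¬A is open.  Formulas
-- are countable, so enumerate them and extend ¬A Lindenbaum-style, adding
-- each formula unless that would let the branch close.  The limit H is a
-- maximal set no finite part of which closes; hence whenever a tableau rule
-- applies to a formula of H, the formulas of (one of) its conclusions lie in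
-- H as well.  The canonical model puts A into E(t) iff ¬t:A ∉ H and makes p
-- true iff p ∈ H.  The tableau rules are exactly what is needed for the
-- conditions (E1)–(E7), and by a truth lemma the model forces every formula
-- of H and no formula whose negation is in H; in particular it refutes A.

module Submission where

open import Defs
open import Data.Nat using (ℕ; zero; suc; _⊔_; _≤′_; ≤′-refl; ≤′-step)
open import Data.Nat.Properties using (m≤m⊔n; m≤n⊔m; ≤⇒≤′)
open import Data.Nat.Binary using (ℕᵇ; 2[1+_]; 1+[2_]) renaming (zero to zeroᵇ; toℕ to toℕᵇ)
open import Data.Nat.Binary.Properties using (toℕ-injective; 2[1+_]-injective)
open import Data.Bool using (Bool; true; false; T)
open import Data.List using (List; _∷_; []; _++_)
open import Data.List.Membership.Propositional using (_∈_)
open import Data.List.Membership.Propositional.Properties using (∈-++⁺ˡ; ∈-++⁺ʳ)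
open import Data.List.Relation.Unary.Any using (here; there)
open import Data.List.Relation.Unary.All as All using (All; _∷_; [])
open import Data.List.Relation.Unary.All.Properties using (++⁺)
open import Data.List.Relation.Binary.Subset.Propositional using (_⊆_)
open import Data.List.Relation.Binary.Subset.Propositional.Properties using (∷⁺ʳ; xs⊆xs++ys; xs⊆ys++xs)
open import Data.Product using (_×_; Σ; ∃; ∃-syntax; _,_; proj₁; proj₂)
open import Data.Sum using (_⊎_; inj₁; inj₂; [_,_]′)
open import Data.Unit using (tt)
open import Data.Empty using (⊥-elim)
open import Function using (_∘_; id)
open import Relation.Nullary using (¬_; Dec; yes; no; does; contradiction)
open import Relation.Nullary.Decidable using (dec-true; dec-false; decidable-stable)
open import Relation.Binary.PropositionalEquality using (_≡_; refl; sym; trans; cong; cong₂)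

data Tree : Set where
  node : ℕ → List Tree → Tree

-- Prefix codes written into the bits of a binary natural, least
-- significant bit first; each is injective in both arguments jointly.

unary : ℕ → ℕᵇ → ℕᵇ
unary zero    r = 1+[2 r ]
unary (suc n) r = 2[1+ unary n r ]

encodeTree : Tree → ℕᵇ → ℕᵇ
encodeForest : List Tree → ℕᵇ → ℕᵇ

encodeTree (node n ts) r = unary n (encodeForest ts r)

encodeForest []       r = 1+[2 r ]
encodeForest (t ∷ ts) r = 2[1+ encodeTree t (encodeForest ts r) ]

unary-injective : ∀ m n {r s} → unary m r ≡ unary n s → m ≡ n × r ≡ s
unary-injective zero    zero    refl = refl , refl
unary-injective (suc m) (suc n) e with unary-injective m n (2[1+_]-injective e)
... | refl , refl = refl , refl
unary-injective zero    (suc n) ()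
unary-injective (suc m) zero    ()

encodeTree-injective : ∀ t u {r s} → encodeTree t r ≡ encodeTree u s → t ≡ u × r ≡ s
encodeForest-injective : ∀ ts us {r s} → encodeForest ts r ≡ encodeForest us s → ts ≡ us × r ≡ s

encodeTree-injective (node m ts) (node n us) e with unary-injective m n e
... | refl , e′ with encodeForest-injective ts us e′
... | refl , refl = refl , refl

encodeForest-injective []       []       refl = refl , refl
encodeForest-injective (t ∷ ts) (u ∷ us) e with encodeTree-injective t u (2[1+_]-injective e)
... | refl , e′ with encodeForest-injective ts us e′
... | refl , refl = refl , refl
encodeForest-injective []      (_ ∷ _) ()
encodeForest-injective (_ ∷ _) []      ()

whenT : {A : Set} (b : Bool) → (T b → A) → A → A
whenT true  f _ = f tt
whenT false _ a = a

whenT-T : ∀ {A : Set} {b f} {a : A} (p : T b) → whenT b f a ≡ f p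
whenT-T {b = true} tt = refl

ifT-intro : ∀ b {P : Set} → (T b → P) → ifT b P
ifT-intro true  f = f tt
ifT-intro false _ = tt

module _ {L : Logic} where

  leaf : ℕ → Tree
  leaf n = node n []

  toTreeᵗ : Tm L → Tree
  toTreeᵗ (var n)  = node 0 (leaf n ∷ [])
  toTreeᵗ (con n)  = node 1 (leaf n ∷ [])
  toTreeᵗ (s · t)  = node 2 (toTreeᵗ s ∷ toTreeᵗ t ∷ [])
  toTreeᵗ (s +ₜ t) = node 3 (toTreeᵗ s ∷ toTreeᵗ t ∷ [])
  toTreeᵗ (! t)    = node 4 (toTreeᵗ t ∷ [])
  toTreeᵗ (¿ t)    = node 5 (toTreeᵗ t ∷ [])
  toTreeᵗ (⁇ t)    = node 6 (toTreeᵗ t ∷ [])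

  -- Left inverses only: trees coding no term (formula) go to var 0 (⊥f).
  fromTreeᵗ : Tree → Tm L
  fromTreeᵗ (node 0 (node n [] ∷ []))  = var n
  fromTreeᵗ (node 1 (node n [] ∷ []))  = con n
  fromTreeᵗ (node 2 (s ∷ t ∷ []))      = fromTreeᵗ s · fromTreeᵗ t
  fromTreeᵗ (node 3 (s ∷ t ∷ []))      = fromTreeᵗ s +ₜ fromTreeᵗ t
  fromTreeᵗ (node 4 (t ∷ []))          = whenT (j4 L) (λ p → !_ {p = p} (fromTreeᵗ t)) (var 0)
  fromTreeᵗ (node 5 (t ∷ []))          = whenT (jB L) (λ p → ¿_ {p = p} (fromTreeᵗ t)) (var 0)
  fromTreeᵗ (node 6 (t ∷ []))          = whenT (j5 L) (λ p → ⁇_ {p = p} (fromTreeᵗ t)) (var 0)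
  fromTreeᵗ _                          = var 0

  fromTreeᵗ-toTreeᵗ : ∀ t → fromTreeᵗ (toTreeᵗ t) ≡ t
  fromTreeᵗ-toTreeᵗ (var n)      = refl
  fromTreeᵗ-toTreeᵗ (con n)      = refl
  fromTreeᵗ-toTreeᵗ (s · t)      = cong₂ _·_ (fromTreeᵗ-toTreeᵗ s) (fromTreeᵗ-toTreeᵗ t)
  fromTreeᵗ-toTreeᵗ (s +ₜ t)     = cong₂ _+ₜ_ (fromTreeᵗ-toTreeᵗ s) (fromTreeᵗ-toTreeᵗ t)
  fromTreeᵗ-toTreeᵗ (!_ {p} t)   = trans (whenT-T p) (cong (!_ {p = p}) (fromTreeᵗ-toTreeᵗ t))
  fromTreeᵗ-toTreeᵗ (¿_ {p} t)   = trans (whenT-T p) (cong (¿_ {p = p}) (fromTreeᵗ-toTreeᵗ t))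
  fromTreeᵗ-toTreeᵗ (⁇_ {p} t)   = trans (whenT-T p) (cong (⁇_ {p = p}) (fromTreeᵗ-toTreeᵗ t))

  toTree : Fm L → Tree
  toTree (at n)  = node 0 (leaf n ∷ [])
  toTree ⊥f      = node 1 []
  toTree (~ A)   = node 2 (toTree A ∷ [])
  toTree (A ⇒ B) = node 3 (toTree A ∷ toTree B ∷ [])
  toTree (t ∶ A) = node 4 (toTreeᵗ t ∷ toTree A ∷ [])

  fromTree : Tree → Fm L
  fromTree (node 0 (node n [] ∷ [])) = at n
  fromTree (node 2 (A ∷ []))         = ~ fromTree A
  fromTree (node 3 (A ∷ B ∷ []))     = fromTree A ⇒ fromTree B
  fromTree (node 4 (t ∷ A ∷ []))     = fromTreeᵗ t ∶ fromTree A
  fromTree _                         = ⊥f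

  fromTree-toTree : ∀ A → fromTree (toTree A) ≡ A
  fromTree-toTree (at n)  = refl
  fromTree-toTree ⊥f      = refl
  fromTree-toTree (~ A)   = cong ~_ (fromTree-toTree A)
  fromTree-toTree (A ⇒ B) = cong₂ _⇒_ (fromTree-toTree A) (fromTree-toTree B)
  fromTree-toTree (t ∶ A) = cong₂ _∶_ (fromTreeᵗ-toTreeᵗ t) (fromTree-toTree A)

  toTree-injective : ∀ {A B} → toTree A ≡ toTree B → A ≡ B
  toTree-injective {A} {B} e =
    trans (sym (fromTree-toTree A)) (trans (cong fromTree e) (fromTree-toTree B))

  code : Fm L → ℕ
  code A = toℕᵇ (encodeTree (toTree A) zeroᵇ)

  code-injective : ∀ {A B} → code A ≡ code B → A ≡ B
  code-injective = toTree-injective ∘ proj₁ ∘ encodeTree-injective _ _ ∘ toℕ-injective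

closed-mono : ∀ {L 𝒞 Γ Δ} → Γ ⊆ Δ → ClosedTableau L 𝒞 Γ → ClosedTableau L 𝒞 Δ
closed-mono s (clash A a b)         = clash A (s a) (s b)
closed-mono s (clashBot b)          = clashBot (s b)
closed-mono s (clashCS c F m x)     = clashCS c F (s m) x
closed-mono s (F¬ A m c)            = F¬ A (s m) (closed-mono (∷⁺ʳ _ s) c)
closed-mono s (F⇒ A B m c)          = F⇒ A B (s m) (closed-mono (∷⁺ʳ _ (∷⁺ʳ _ s)) c)
closed-mono s (T⇒ A B m c d)        = T⇒ A B (s m) (closed-mono (∷⁺ʳ _ s) c) (closed-mono (∷⁺ʳ _ s) d)
closed-mono s (F+ t u A m c)        = F+ t u A (s m) (closed-mono (∷⁺ʳ _ (∷⁺ʳ _ s)) c)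
closed-mono s (F· u t B m A c d)    = F· u t B (s m) A (closed-mono (∷⁺ʳ _ s) c) (closed-mono (∷⁺ʳ _ s) d)
closed-mono s (T∶ q t A m c)        = T∶ q t A (s m) (closed-mono (∷⁺ʳ _ s) c)
closed-mono s (F∶⊥ q t c)           = F∶⊥ q t (closed-mono (∷⁺ʳ _ s) c)
closed-mono s (F! p t A m c)        = F! p t A (s m) (closed-mono (∷⁺ʳ _ s) c)
closed-mono s (F¿ p t A m c)        = F¿ p t A (s m) (closed-mono (∷⁺ʳ _ s) c)
closed-mono s (F⁇ p t A m c)        = F⁇ p t A (s m) (closed-mono (∷⁺ʳ _ s) c)

module Completeness (lem : ExcludedMiddle) {L : Logic} (𝒞 : CS L) where

  Closed : List (Fm L) → Set
  Closed = ClosedTableau L 𝒞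

  record MaximalConsistent (H : Fm L → Set) : Set where
    field
      consistent : ∀ {Γ} → All H Γ → ¬ Closed Γ
      refute     : ∀ {A} → ¬ H A → ∃[ Γ ] All H Γ × Closed (A ∷ Γ)

  Candidate : ℕ → List (Fm L) → Fm L → Set
  Candidate n Γ A = code A ≡ n × ¬ Closed (A ∷ Γ)

  extend : ∀ {n Γ} → Dec (∃ (Candidate n Γ)) → List (Fm L)
  extend {Γ = Γ} (yes (A , _)) = A ∷ Γ
  extend {Γ = Γ} (no _)        = Γ

  ⊆-extend : ∀ {n Γ} (d : Dec (∃ (Candidate n Γ))) → Γ ⊆ extend d
  ⊆-extend (yes _) = there
  ⊆-extend (no _)  = id

  extend-open : ∀ {n Γ} (d : Dec (∃ (Candidate n Γ))) → ¬ Closed Γ → ¬ Closed (extend d)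
  extend-open (yes (_ , _ , open′)) _ = open′
  extend-open (no _)                open′ = open′

  ∈-extend : ∀ {n Γ A} (d : Dec (∃ (Candidate n Γ))) → Candidate n Γ A → A ∈ extend d
  ∈-extend (yes (B , codeB , _)) (codeA , _) = here (code-injective (trans codeA (sym codeB)))
  ∈-extend {A = A} (no none)     candidate   = contradiction (A , candidate) none

  module Lindenbaum (Γ₀ : List (Fm L)) (Γ₀-open : ¬ Closed Γ₀) where

    stage : ℕ → List (Fm L)
    stage zero    = Γ₀
    stage (suc n) = extend (lem (∃ (Candidate n (stage n))))

    stage-open : ∀ n → ¬ Closed (stage n)
    stage-open zero    = Γ₀-open
    stage-open (suc n) = extend-open (lem _) (stage-open n)

    stage-mono : ∀ {m n} → m ≤′ n → stage m ⊆ stage n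
    stage-mono ≤′-refl      = id
    stage-mono (≤′-step le) = ⊆-extend (lem _) ∘ stage-mono le

    Limit : Fm L → Set
    Limit A = ∃[ n ] A ∈ stage n

    ⊆-stage : ∀ {Γ} → All Limit Γ → ∃[ N ] Γ ⊆ stage N
    ⊆-stage []              = 0 , λ ()
    ⊆-stage ((n , A∈) ∷ Γ⊆) with ⊆-stage Γ⊆
    ... | N , Γ⊆N = n ⊔ N , λ
      { (here refl) → stage-mono (≤⇒≤′ (m≤m⊔n n N)) A∈
      ; (there B∈)  → stage-mono (≤⇒≤′ (m≤n⊔m n N)) (Γ⊆N B∈) }

    limit-maximalConsistent : MaximalConsistent Limit
    limit-maximalConsistent = record
      { consistent = λ Γ⊆ closed →
          let N , Γ⊆N = ⊆-stage Γ⊆ in stage-open N (closed-mono Γ⊆N closed)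
      ; refute = λ {A} A∉ →
          stage (code A) , All.tabulate (code A ,_) ,
          decidable-stable (lem _) λ open′ → A∉ (suc (code A) , ∈-extend (lem _) (refl , open′))
      }

  lindenbaum : ∀ {Γ₀} → ¬ Closed Γ₀ → Σ (Fm L → Set) λ H → MaximalConsistent H × All H Γ₀
  lindenbaum Γ₀-open = Limit , limit-maximalConsistent , All.tabulate (0 ,_)
    where open Lindenbaum _ Γ₀-open

  module Canonical {H : Fm L → Set} (maximal : MaximalConsistent H) where
    open MaximalConsistent maximal

    noClash : ∀ {A} → H A → ¬ H (~ A)
    noClash {A} a ¬a = consistent (a ∷ ¬a ∷ []) (clash A (here refl) (there (here refl)))

    ∈-if-consistent : ∀ {A} → (∀ {Γ} → All H Γ → ¬ Closed (A ∷ Γ)) → H A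
    ∈-if-consistent consistentWith = decidable-stable (lem _) λ A∉ →
      let _ , Γ⊆ , closed = refute A∉ in consistentWith Γ⊆ closed

    expand : ∀ {P} Gs → H P → (∀ {Δ} → P ∈ Δ → Closed (Gs ++ Δ) → Closed Δ) → All H Gs
    expand Gs P∈ rule = All.tabulate λ G∈Gs → ∈-if-consistent λ Γ⊆ closed →
      consistent (P∈ ∷ Γ⊆) (rule (here refl) (closed-mono
        (λ { (here refl) → ∈-++⁺ˡ G∈Gs ; (there B∈) → ∈-++⁺ʳ Gs (there B∈) }) closed))

    expand₁ : ∀ {P G} → H P → (∀ {Δ} → P ∈ Δ → Closed (G ∷ Δ) → Closed Δ) → H G
    expand₁ P∈ rule = All.head (expand (_ ∷ []) P∈ rule)

    branch : ∀ {P X Y} → H P → (∀ {Δ} → P ∈ Δ → Closed (X ∷ Δ) → Closed (Y ∷ Δ) → Closed Δ)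
           → H X ⊎ H Y
    branch {X = X} {Y} P∈ rule with lem (H X) | lem (H Y)
    ... | yes X∈ | _      = inj₁ X∈
    ... | no _   | yes Y∈ = inj₂ Y∈
    ... | no X∉  | no Y∉  with refute X∉ | refute Y∉
    ... | Γ₁ , Γ₁⊆ , closed₁ | Γ₂ , Γ₂⊆ , closed₂ =
      ⊥-elim (consistent (P∈ ∷ ++⁺ Γ₁⊆ Γ₂⊆) (rule (here refl)
        (closed-mono (∷⁺ʳ X (there ∘ xs⊆xs++ys Γ₁ Γ₂)) closed₁)
        (closed-mono (∷⁺ʳ Y (there ∘ xs⊆ys++xs Γ₂ Γ₁)) closed₂)))

    +-saturated : ∀ {s t A} → H (~ ((s +ₜ t) ∶ A)) → H (~ (s ∶ A)) × H (~ (t ∶ A))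
    +-saturated {s} {t} {A} s+t∈ with expand (_ ∷ _ ∷ []) s+t∈ (F+ s t A)
    ... | s∈ ∷ t∈ ∷ [] = s∈ , t∈

    Eᶜ : Tm L → Fm L → Set
    Eᶜ t A = ¬ H (~ (t ∶ A))

    Vᶜ : ℕ → Bool
    Vᶜ p = does (lem (H (at p)))

    truth   : ∀ A → H A → Forces Eᶜ Vᶜ A
    falsity : ∀ A → H (~ A) → ¬ Forces Eᶜ Vᶜ A

    truth (at p)  p∈   = dec-true (lem _) p∈
    truth ⊥f      ⊥∈   = consistent (⊥∈ ∷ []) (clashBot (here refl))
    truth (~ A)   ¬A∈  = falsity A ¬A∈
    truth (A ⇒ B) A⇒B∈ with branch A⇒B∈ (T⇒ A B)
    ... | inj₁ ¬A∈ = λ a → ⊥-elim (falsity A ¬A∈ a)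
    ... | inj₂ B∈  = λ _ → truth B B∈
    truth (t ∶ A) t∶A∈ = noClash t∶A∈ , ifT-intro (jT L) λ q → truth A (expand₁ t∶A∈ (T∶ q t A))

    falsity (at p)  ¬p∈ p-true =
      contradiction (trans (sym p-true) (dec-false (lem _) λ p∈ → noClash p∈ ¬p∈)) λ ()
    falsity ⊥f      _   ()
    falsity (~ A)   ¬¬A∈ ¬A = ¬A (truth A (expand₁ ¬¬A∈ (F¬ A)))
    falsity (A ⇒ B) ¬A⇒B∈ A⇒B with expand (_ ∷ _ ∷ []) ¬A⇒B∈ (F⇒ A B)
    ... | A∈ ∷ ¬B∈ ∷ [] = falsity B ¬B∈ (A⇒B (truth A A∈))
    falsity (t ∶ A) ¬t∶A∈ (t∶A∈E , _) = t∶A∈E ¬t∶A∈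

    model : Model L 𝒞
    model = record
      { E  = Eᶜ
      ; V  = Vᶜ
      ; E1 = λ s t A B s∈ t∈ st∈ → [ s∈ , t∈ ]′ (branch st∈ λ m → F· s t B m A)
      ; E2 = λ s t A → (λ s∈ → s∈ ∘ proj₁ ∘ +-saturated) , (λ t∈ → t∈ ∘ proj₂ ∘ +-saturated)
      ; E3 = λ c F c∶F∈𝒞 ¬c∶F∈ → consistent (¬c∶F∈ ∷ []) (clashCS c F (here refl) c∶F∈𝒞)
      ; E4 = λ q t ⊥∈ → ⊥∈ (∈-if-consistent λ Γ⊆ closed → consistent Γ⊆ (F∶⊥ q t closed))
      ; E5 = λ p t A A∈ ¬!t∈ → A∈ (expand₁ ¬!t∈ (F! p t A))
      ; E6 = λ p t A ⊮A ¬¿t∈ → ⊮A (truth A (expand₁ ¬¿t∈ (F¿ p t A)))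
      ; E7 = λ p t A A∉ ¬⁇t∈ → noClash (expand₁ ¬⁇t∈ (F⁇ p t A)) (decidable-stable (lem _) A∉)
      }

theorem3 : ExcludedMiddle → (L : Logic) (𝒞 : CS L) (A : Fm L) → Valid L 𝒞 A → TableauProof L 𝒞 A
theorem3 lem L 𝒞 A valid = decidable-stable (lem _) λ unprovable →
  let H , maximal , ¬A∈H = lindenbaum unprovable
  in  Canonical.falsity maximal A (All.head ¬A∈H) (valid (Canonical.model maximal))
  where open Completeness lem 𝒞
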